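{- Let $S_L$ be any nonempty finite set of positive integers. Let $p$ be the period of the outcome sequence of the impartial subtraction game $(S_L,S_L)$, and let $S_R=S_L\cup\{p\}$. Then Right strongly dominates the game $(S_L,S_R)$, i.e. there exists $n_0$ such that $o(n)=\mathcal R$ for all $n\ge n_0$.
   Context: A partizan subtraction game $(S_L,S_R)$, with $S_L,S_R$ finite sets of positive integers, is played on a heap of $n$ tokens. Two players, Left and Right, alternate moves; Left removes $s\in S_L$ tokens and Right removes $s\in S_R$ tokens (at most the current heap size). A player unable to move loses. The outcome $o(n)$ is $\mathcal L$ (Left wins whoever starts), $\mathcal R$ (Right wins whoever starts), $\mathcal N$ (first player wins) or $\mathcal P$ (second player wins). When $S_L=S_R$ the game is impartial; its outcome sequence $o(0),o(1),\ldots$ (taking values $\mathcal P,\mathcal N$) is ultimately periodic, and $p$ denotes the length of its period. -}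

module Defs where

open import Data.Nat using (ℕ; zero; suc; _+_; _≤_; _<_)
open import Data.Bool using (Bool; true; false; not)
open import Data.List using (List; []; _∷_)
open import Data.Bool.ListAction using (any)
open import Data.Product using (_×_; _,_; ∃-syntax)
open import Relation.Binary.PropositionalEquality using (_≡_)

-- History of a play: entry i records the results at heap size (n-1-i)
-- as a pair (Left-moving-first wins , Right-moving-first wins).
History : Set
History = List (Bool × Bool)

-- Result at heap size n - (k+1), if it exists (i.e. k+1 ≤ n).
-- Moving removes s tokens; s = 0 is never a legal move here.
leftMoveWins : History → ℕ → Bool
leftMoveWins h zero = false
leftMoveWins [] (suc k) = false
leftMoveWins ((lf , rf) ∷ h) (suc zero) = not rf
leftMoveWins (_ ∷ h) (suc (suc k)) = leftMoveWins h (suc k)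

rightMoveWins : History → ℕ → Bool
rightMoveWins h zero = false
rightMoveWins [] (suc k) = false
rightMoveWins ((lf , rf) ∷ h) (suc zero) = not lf
rightMoveWins (_ ∷ h) (suc (suc k)) = rightMoveWins h (suc k)

step : List ℕ → List ℕ → History → Bool × Bool
step SL SR h = any (leftMoveWins h) SL , any (rightMoveWins h) SR

history : List ℕ → List ℕ → ℕ → History
history SL SR zero = []
history SL SR (suc n) = step SL SR (history SL SR n) ∷ history SL SR n

data Outcome : Set where
  𝓛 𝓡 𝓝 𝓟 : Outcome

classify : Bool × Bool → Outcome
classify (true , false) = 𝓛
classify (false , true) = 𝓡
classify (true , true) = 𝓝
classify (false , false) = 𝓟

o : List ℕ → List ℕ → ℕ → Outcome
o SL SR n = classify (step SL SR (history SL SR n))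

IsEventualPeriod : List ℕ → ℕ → Set
IsEventualPeriod S q = ∃[ n₀ ] (∀ n → n₀ ≤ n → o S S (n + q) ≡ o S S n)

IsPeriod : List ℕ → ℕ → Set
IsPeriod S p = (0 < p) × IsEventualPeriod S p
             × (∀ q → 0 < q → IsEventualPeriod S q → p ≤ q)

-- In the impartial game (S,S) Left and Right win moving first at exactly the same heaps, and
-- giving Right an extra move can only help Right.  Take n = p + m with m large.  If the first
-- player wins (S,S) at n, Right wins moving first there in (S, p ∷ S) by monotonicity.  Otherwise
-- n is a P-position of (S,S), hence so is m by periodicity; Left moving first loses at m in
-- (S, p ∷ S), again by monotonicity, so Right wins from n by removing p.  Thus Right wins moving
-- first at every large heap, and then Left loses moving first once all her moves land at large
-- heaps.  Only the eventual periodicity of (S,S) with period p > 0 is used.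
module Submission where

open import Defs
open import Data.Nat using (ℕ; zero; suc; _+_; _∸_; _⊔_; _≤_; _<_)
open import Data.Nat.Properties
  using ( ≤-trans; m≤m⊔n; m≤n⊔m; m≤m+n; m≤n+m; +-comm; +-monoʳ-≤
        ; m+[n∸m]≡n; m+n≤o⇒m≤o∸n; m+n≤o⇒n≤o )
open import Data.Nat.ListAction using (sum)
open import Data.Bool using (Bool; true; false; not; T)
open import Data.Bool.ListAction using (any; or)
open import Data.List using (List; _∷_; [])
open import Data.List.Properties using (map-cong)
open import Data.List.Membership.Propositional using (_∈_; lose)
open import Data.List.Relation.Binary.Subset.Propositional using (_⊆_)
open import Data.List.Relation.Binary.Subset.Propositional.Properties as Subset using (⊆-refl)
open import Data.List.Relation.Unary.All as All using (All; _∷_; [])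
open import Data.List.Relation.Unary.Any as Any using (here; there)
import Data.List.Relation.Unary.Any.Properties as Any
open import Data.Product using (∃-syntax; _×_; _,_; proj₁; proj₂)
open import Data.Empty using (⊥-elim)
open import Function using (_∘′_)
open import Relation.Nullary using (¬_)
open import Relation.Binary.PropositionalEquality
  using (_≡_; _≢_; refl; sym; trans; cong; subst; module ≡-Reasoning)

leftFirstWins : List ℕ → List ℕ → ℕ → Bool
leftFirstWins SL SR n = proj₁ (step SL SR (history SL SR n))

rightFirstWins : List ℕ → List ℕ → ℕ → Bool
rightFirstWins SL SR n = proj₂ (step SL SR (history SL SR n))

leftMoveWins-history : ∀ SL SR k m →
  leftMoveWins (history SL SR (suc k + m)) (suc k) ≡ not (rightFirstWins SL SR m)
leftMoveWins-history SL SR zero    m = refl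
leftMoveWins-history SL SR (suc k) m = leftMoveWins-history SL SR k m

rightMoveWins-history : ∀ SL SR k m →
  rightMoveWins (history SL SR (suc k + m)) (suc k) ≡ not (leftFirstWins SL SR m)
rightMoveWins-history SL SR zero    m = refl
rightMoveWins-history SL SR (suc k) m = rightMoveWins-history SL SR k m

any-mono : ∀ {A : Set} {f g : A → Bool} → (∀ x → T (f x) → T (g x)) →
  ∀ xs → T (any f xs) → T (any g xs)
any-mono {f = f} {g} f⇒g xs = Any.any⁺ g ∘′ Any.map (f⇒g _) ∘′ Any.any⁻ f xs

T-not-contravariant : ∀ {a b} → (T a → T b) → T (not b) → T (not a)
T-not-contravariant {false}         a⇒b _  = _
T-not-contravariant {true}  {false} a⇒b _  = a⇒b _
T-not-contravariant {true}  {true}  a⇒b ()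

T⇒¬T-not : ∀ {b} → T b → ¬ T (not b)
T⇒¬T-not {true} _ ()

module _ {SL SR SL′ SR′ : List ℕ} (SL′⊆SL : SL′ ⊆ SL) (SR⊆SR′ : SR ⊆ SR′) where

  leftMoveWins-mono : ∀ n k →
    T (leftMoveWins (history SL′ SR′ n) k) → T (leftMoveWins (history SL SR n) k)
  rightMoveWins-mono : ∀ n k →
    T (rightMoveWins (history SL SR n) k) → T (rightMoveWins (history SL′ SR′ n) k)
  leftFirstWins-mono : ∀ n → T (leftFirstWins SL′ SR′ n) → T (leftFirstWins SL SR n)
  rightFirstWins-mono : ∀ n → T (rightFirstWins SL SR n) → T (rightFirstWins SL′ SR′ n)

  leftMoveWins-mono (suc m) (suc zero)    = T-not-contravariant (rightFirstWins-mono m)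
  leftMoveWins-mono (suc m) (suc (suc k)) = leftMoveWins-mono m (suc k)

  rightMoveWins-mono (suc m) (suc zero)    = T-not-contravariant (leftFirstWins-mono m)
  rightMoveWins-mono (suc m) (suc (suc k)) = rightMoveWins-mono m (suc k)

  leftFirstWins-mono n w = Subset.any⁺ _ SL′⊆SL (any-mono (leftMoveWins-mono n) SL′ w)
  rightFirstWins-mono n w = Subset.any⁺ _ SR⊆SR′ (any-mono (rightMoveWins-mono n) SR w)

module _ (S : List ℕ) where

  leftMoveWins≡rightMoveWins-impartial : ∀ n k →
    leftMoveWins (history S S n) k ≡ rightMoveWins (history S S n) k
  leftFirstWins≡rightFirstWins-impartial : ∀ n → leftFirstWins S S n ≡ rightFirstWins S S n

  leftMoveWins≡rightMoveWins-impartial zero    zero          = refl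
  leftMoveWins≡rightMoveWins-impartial zero    (suc k)       = refl
  leftMoveWins≡rightMoveWins-impartial (suc m) zero          = refl
  leftMoveWins≡rightMoveWins-impartial (suc m) (suc zero)    =
    cong not (sym (leftFirstWins≡rightFirstWins-impartial m))
  leftMoveWins≡rightMoveWins-impartial (suc m) (suc (suc k)) =
    leftMoveWins≡rightMoveWins-impartial m (suc k)

  leftFirstWins≡rightFirstWins-impartial n =
    cong or (map-cong (leftMoveWins≡rightMoveWins-impartial n) S)

classify-diagonal-injective : ∀ a b → classify (a , a) ≡ classify (b , b) → a ≡ b
classify-diagonal-injective true  true  _ = refl
classify-diagonal-injective false false _ = refl

o-impartial : ∀ S n → o S S n ≡ classify (leftFirstWins S S n , leftFirstWins S S n)
o-impartial S n = cong (λ r → classify (leftFirstWins S S n , r))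
                       (sym (leftFirstWins≡rightFirstWins-impartial S n))

leftFirstWins-periodic : ∀ S p n → o S S (n + p) ≡ o S S n →
  leftFirstWins S S (p + n) ≡ leftFirstWins S S n
leftFirstWins-periodic S p n o-periodic = classify-diagonal-injective _ _ (begin
  classify (leftFirstWins S S (p + n) , leftFirstWins S S (p + n)) ≡⟨ sym (o-impartial S (p + n)) ⟩
  o S S (p + n)                                                  ≡⟨ cong (o S S) (+-comm p n) ⟩
  o S S (n + p)                                                  ≡⟨ o-periodic ⟩
  o S S n                                                        ≡⟨ o-impartial S n ⟩
  classify (leftFirstWins S S n , leftFirstWins S S n)           ∎)
  where open ≡-Reasoning

rightFirstWins-after-period : ∀ {SL SR} k → SL ⊆ SR → suc k ∈ SR → ∀ m →
  leftFirstWins SL SL (suc k + m) ≡ leftFirstWins SL SL m → T (rightFirstWins SL SR (suc k + m))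
rightFirstWins-after-period {SL} {SR} k SL⊆SR p∈SR m periodic
  with leftFirstWins SL SL m in lf-m
... | true  = rightFirstWins-mono (⊆-refl {x = SL}) SL⊆SR (suc k + m)
                (subst T (trans (sym periodic) (leftFirstWins≡rightFirstWins-impartial SL (suc k + m))) _)
... | false = Any.any⁺ _ (lose p∈SR moving-p-wins)
  where
  leftFirst-loses : T (not (leftFirstWins SL SR m))
  leftFirst-loses = T-not-contravariant (leftFirstWins-mono (⊆-refl {x = SL}) SL⊆SR m)
                                        (subst (T ∘′ not) (sym lf-m) _)

  moving-p-wins : T (rightMoveWins (history SL SR (suc k + m)) (suc k))
  moving-p-wins = subst T (sym (rightMoveWins-history SL SR k m)) leftFirst-loses

Eventually : (ℕ → Set) → Set
Eventually P = ∃[ N ] (∀ n → N ≤ n → P n)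

eventually-map : ∀ {P Q : ℕ → Set} → (∀ n → P n → Q n) → Eventually P → Eventually Q
eventually-map P⇒Q (N , p) = N , λ n N≤n → P⇒Q n (p n N≤n)

eventually-× : ∀ {P Q : ℕ → Set} → Eventually P → Eventually Q → Eventually (λ n → P n × Q n)
eventually-× (M , p) (N , q) =
  M ⊔ N , λ n M⊔N≤n → p n (≤-trans (m≤m⊔n M N) M⊔N≤n) , q n (≤-trans (m≤n⊔m M N) M⊔N≤n)

eventually-shift : ∀ {P : ℕ → Set} k → Eventually (λ m → P (k + m)) → Eventually P
eventually-shift {P} k (N , p) = N + k , λ n N+k≤n →
  subst P (m+[n∸m]≡n (m+n≤o⇒n≤o N N+k≤n)) (p (n ∸ k) (m+n≤o⇒m≤o∸n N N+k≤n))

rightFirstWins-eventually : ∀ {SL SR} k → SL ⊆ SR → suc k ∈ SR →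
  IsEventualPeriod SL (suc k) → Eventually (T ∘′ rightFirstWins SL SR)
rightFirstWins-eventually {SL} k SL⊆SR p∈SR o-periodic =
  eventually-shift (suc k) (eventually-map
    (λ m → rightFirstWins-after-period k SL⊆SR p∈SR m ∘′ leftFirstWins-periodic SL (suc k) m)
    o-periodic)

≤-sum : ∀ xs → All (_≤ sum xs) xs
≤-sum []       = []
≤-sum (x ∷ xs) = m≤m+n x (sum xs) ∷ All.map (λ y≤ → ≤-trans y≤ (m≤n+m (sum xs) x)) (≤-sum xs)

leftMoveWins-against-rightFirstWin : ∀ SL SR x m → T (rightFirstWins SL SR m) →
  ¬ T (leftMoveWins (history SL SR (x + m)) x)
leftMoveWins-against-rightFirstWin SL SR zero    m _   ()
leftMoveWins-against-rightFirstWin SL SR (suc k) m win rewrite leftMoveWins-history SL SR k m =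
  T⇒¬T-not win

leftFirstWins-eventually-false : ∀ {SL SR} → Eventually (T ∘′ rightFirstWins SL SR) →
  Eventually (¬_ ∘′ T ∘′ leftFirstWins SL SR)
leftFirstWins-eventually-false {SL} {SR} (N , rightWins) = N + sum SL , leftLoses
  where
  leftLoses : ∀ n → N + sum SL ≤ n → ¬ T (leftFirstWins SL SR n)
  leftLoses n N+ΣSL≤n leftWins with All.lookupAny (≤-sum SL) (Any.any⁻ _ SL leftWins)
  ... | x≤ΣSL , x-wins = leftMoveWins-against-rightFirstWin SL SR x (n ∸ x)
                           (rightWins (n ∸ x) (m+n≤o⇒m≤o∸n N N+x≤n))
                           (subst (λ n → T (leftMoveWins (history SL SR n) x)) n≡x+[n∸x] x-wins)
    where
    x = Any.lookup (Any.any⁻ _ SL leftWins)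
    N+x≤n : N + x ≤ n
    N+x≤n = ≤-trans (+-monoʳ-≤ N x≤ΣSL) N+ΣSL≤n
    n≡x+[n∸x] : n ≡ x + (n ∸ x)
    n≡x+[n∸x] = sym (m+[n∸m]≡n (m+n≤o⇒n≤o N N+x≤n))

classify-𝓡 : ∀ {a b} → ¬ T a → T b → classify (a , b) ≡ 𝓡
classify-𝓡 {false} {true} _ _ = refl
classify-𝓡 {true}         ¬a _ = ⊥-elim (¬a _)

mainTheorem3 : (SL : List ℕ) → SL ≢ [] → All (λ s → 0 < s) SL
    → (p : ℕ) → IsPeriod SL p
    → ∃[ n₀ ] (∀ n → n₀ ≤ n → o SL (p ∷ SL) n ≡ 𝓡)
mainTheorem3 SL _ _ zero    (() , _)
mainTheorem3 SL _ _ (suc k) (_ , o-periodic , _) =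
  eventually-map (λ _ (leftLoses , rightWins) → classify-𝓡 leftLoses rightWins)
    (eventually-× (leftFirstWins-eventually-false {SL} rightFirstWins-eventually′)
                  rightFirstWins-eventually′)
  where
  rightFirstWins-eventually′ : Eventually (T ∘′ rightFirstWins SL (suc k ∷ SL))
  rightFirstWins-eventually′ = rightFirstWins-eventually {SL} k there (here refl) o-periodic
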